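{- Any Extended Polynomial Calculus with square root refutation over $\mathbb{Z}$ (denoted $\mathsf{Ext}$-$\mathsf{PC}^{\sqrt{\ }}_{\mathbb{Z}}$) of $\mathsf{BVP}_n$ requires size $\Omega(2^n)$. Moreover, the absolute value of the nonzero constant $M$ at the end of such a refutation consists of at least $C \cdot 2^n$ bits for some constant $C > 0$, and $M$ is divisible by every prime number less than $2^n$.
   Context: $\mathsf{BVP}_n$ (Binary Value Principle) is the unsatisfiable system $x_1 + 2x_2 + \ldots + 2^{n-1}x_n + 1 = 0$, $x_i^2 - x_i = 0$ for $i=1,\ldots,n$. A $\mathsf{PC}^{\sqrt{\ }}_R$ refutation (Polynomial Calculus with square root over a ring $R$) of a set $\Gamma$ of polynomials is a sequence $R_1,\ldots,R_s$ with $R_s = M$ a nonzero constant of $R$, where each $R_l$ is in $\Gamma$ or is obtained from earlier lines by: $R_l = \alpha R_j + \beta R_k$ with $\alpha,\beta \in R$; $R_l = x_i R_k$ (multiplication by a variable); or $R_l^2 = R_k$ (square root rule). Its size is the sum of the sizes of the lines, where the size of an integer polynomial is $\sum \lceil \log |a_i|\rceil$ over its coefficients $a_i$ (for rational coefficients $p_i/q_i$, $\sum \lceil\log|p_i|\rceil + \lceil \log |q_i|\rceil$). An $\mathsf{Ext}$-$\mathsf{PC}^{\sqrt{\ }}_R$ refutation of $\Gamma$ is a $\mathsf{PC}^{\sqrt{\ }}_R$ refutation of $\Gamma \cup \{y_1 - Q_1(\vec x), y_2 - Q_2(\vec x, y_1), \ldots, y_m - Q_m(\vec x, y_1,\ldots,y_{m-1})\}$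 for arbitrary polynomials $Q_i$ over $R$ (extension variables $y_i$, which may also be used in multiplication steps); its size is the size of that refutation. -}

module Defs where

open import Data.Nat as ℕ using (ℕ; zero; suc; _≤_; _<_; _^_)
open import Data.Nat.Logarithm using (⌈log₂_⌉)
open import Data.Integer as ℤ using (ℤ; +_; ∣_∣)
open import Data.Fin as Fin using (Fin; toℕ; _↑ˡ_; _↑ʳ_)
open import Data.Vec as Vec using (Vec; lookup; replicate; zipWith; updateAt)
open import Data.Vec.Properties using (≡-dec)
open import Data.List as List using (List; []; _∷_; _++_; map; concatMap; allFin)
open import Data.Nat.ListAction using (sum)
open import Data.List.Relation.Unary.All using (All)
open import Data.List.Relation.Unary.Any using (Any)
open import Data.List.Relation.Unary.AllPairs using (AllPairs)
open import Data.List.Membership.Propositional using (_∈_)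
open import Data.Product using (_×_; _,_; proj₁; proj₂)
open import Relation.Nullary using (¬_; does)
open import Relation.Binary.PropositionalEquality using (_≡_; _≢_)
open import Data.Bool using (if_then_else_)

-- A monomial is its exponent vector; a polynomial is given by a list of
-- terms (coefficient, monomial).  Two term lists denote the same
-- polynomial iff they have the same coefficient at every monomial.

Monomial : ℕ → Set
Monomial N = Vec ℕ N

Terms : ℕ → Set
Terms N = List (ℤ × Monomial N)

_≟ₘ_ : ∀ {N} (m m' : Monomial N) → _
_≟ₘ_ = ≡-dec ℕ._≟_

coeff : ∀ {N} → Terms N → Monomial N → ℤ
coeff [] m = + 0
coeff ((a , m') ∷ ts) m =
  (if does (m' ≟ₘ m) then a else + 0) ℤ.+ coeff ts m

_≈_ : ∀ {N} → Terms N → Terms N → Set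
p ≈ q = ∀ m → coeff p m ≡ coeff q m

one : ∀ {N} → Monomial N
one = replicate _ 0

var : ∀ {N} → Fin N → Monomial N
var i = updateAt one i (λ _ → 1)

scale : ∀ {N} → ℤ → Terms N → Terms N
scale α = map (λ { (a , m) → (α ℤ.* a , m) })

neg : ∀ {N} → Terms N → Terms N
neg = scale (ℤ.- (+ 1))

lincomb : ∀ {N} → ℤ → Terms N → ℤ → Terms N → Terms N
lincomb α p β q = scale α p ++ scale β q

mulVar : ∀ {N} → Fin N → Terms N → Terms N
mulVar i = map (λ { (a , m) → (a , updateAt m i suc) })

square : ∀ {N} → Terms N → Terms N
square p = concatMap (λ { (a , m) → map (λ { (b , m') → (a ℤ.* b , zipWith ℕ._+_ m m') }) p }) p

const : ∀ {N} → ℤ → Terms N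
const M = (M , one) ∷ []

-- A term list is in canonical form if its monomials are pairwise distinct
-- and all its coefficients are nonzero; then it lists exactly the nonzero
-- coefficients of the polynomial, so the size below is well defined.
Canonical : ∀ {N} → Terms N → Set
Canonical p = AllPairs _≢_ (map proj₂ p) × All (λ t → proj₁ t ≢ + 0) p

polySize : ∀ {N} → Terms N → ℕ
polySize p = sum (map (λ t → ⌈log₂ ∣ proj₁ t ∣ ⌉) p)

-- PC^√ over ℤ.  Lines are listed latest-first: Deriv Γ (R_l ∷ … ∷ R_1 ∷ []).

data Rule {N} (Γ : List (Terms N)) (prev : List (Terms N)) (p : Terms N) : Set where
  axiom   : Any (λ g → p ≈ g) Γ → Rule Γ prev p
  lin     : (α β : ℤ) (q r : Terms N) → q ∈ prev → r ∈ prev →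
            p ≈ lincomb α q β r → Rule Γ prev p
  mulV    : (i : Fin N) (q : Terms N) → q ∈ prev → p ≈ mulVar i q → Rule Γ prev p
  sqrtR   : (q : Terms N) → q ∈ prev → square p ≈ q → Rule Γ prev p

data Deriv {N} (Γ : List (Terms N)) : List (Terms N) → Set where
  []   : Deriv Γ []
  step : ∀ {prev p} → Deriv Γ prev → Canonical p → Rule Γ prev p → Deriv Γ (p ∷ prev)

record Refutation {N} (Γ : List (Terms N)) : Set where
  field
    last   : Terms N
    rest   : List (Terms N)
    deriv  : Deriv Γ (last ∷ rest)
    M      : ℤ
    M≢0    : M ≢ + 0
    last≈M : last ≈ const M

  size : ℕ
  size = sum (map polySize (last ∷ rest))

-- BVP_n in the variables x_1..x_n, y_1..y_m (N = n + m);
-- x_{i+1} is variable inject+ m i, y_{j+1} is variable raise n j.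

xv : ∀ {n} m → Fin n → Fin (n ℕ.+ m)
xv m i = i ↑ˡ m

yv : ∀ n {m} → Fin m → Fin (n ℕ.+ m)
yv n j = n ↑ʳ j

bvpMain : ∀ n m → Terms (n ℕ.+ m)
bvpMain n m = map (λ i → (+ (2 ^ toℕ i) , var (xv m i))) (allFin n) ++ const (+ 1)

boolAx : ∀ {N} → Fin N → Terms N
boolAx i = (+ 1 , updateAt one i (λ _ → 2)) ∷ (ℤ.- (+ 1) , var i) ∷ []

BVP : ∀ n m → List (Terms (n ℕ.+ m))
BVP n m = bvpMain n m ∷ map (λ i → boolAx (xv m i)) (allFin n)

-- Q_{j+1} may only use x_1..x_n and y_1..y_j
ExtAllowed : ∀ n {m} → Fin m → Terms (n ℕ.+ m) → Set
ExtAllowed n {m} j Q =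
  All (λ t → (k : Fin m) → toℕ j ≤ toℕ k → lookup (proj₂ t) (yv n k) ≡ 0) Q

extAxioms : ∀ n m → (Fin m → Terms (n ℕ.+ m)) → List (Terms (n ℕ.+ m))
extAxioms n m Q = map (λ j → (+ 1 , var (yv n j)) ∷ neg (Q j)) (allFin m)

ExtRefutation : ∀ n m → (Fin m → Terms (n ℕ.+ m)) → Set
ExtRefutation n m Q = Refutation (BVP n m ++ extAxioms n m Q)

bits : ℕ → ℕ
bits zero = 0
bits (suc k) = suc (Data.Nat.Logarithm.⌊log₂ suc k ⌋)

-- Let p = k + 1 < 2^n be prime. Set the x_i to the binary digits of k and each extension variable y_j
-- to the value of Q_j there (well defined, as Q_j only reads earlier y's). At this integer point the main
-- axiom evaluates to k + 1 = p and all other axioms to 0, and every rule preserves divisibility by p of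
-- the value of a line: the square-root rule because p is prime. Hence p divides the final constant M.
-- An integer M divisible by every prime below N = 2^n is huge: for s ≈ √N every k < N divides
-- M (s!)^n, since k has at most one prime factor above s, and m (m+1) ⋯ (2m) divides lcm(1, …, 2m) m!
-- while exceeding 2^m m!; so 2^(N/8) ≤ M (s!)^n, and (s!)^n is negligible. As M is a coefficient of the
-- last line, log₂ |M| also bounds the size of the refutation.

module Submission where

open import Defs

module ChebyshevBound where

  open import Data.Nat
  open import Data.Nat.Properties
  open import Data.Nat.Divisibility
  open import Data.Nat.Primality using (Prime; prime⇒nonTrivial; productOfPrimes≥1)
  open import Data.Nat.Primality.Factorisation using (factorise; PrimeFactorisation)
  open import Data.Nat.ListAction using (product)
  open import Data.Nat.Solver using (module +-*-Solver)
  open import Data.List using ([]; _∷_)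
  open import Data.List.Relation.Unary.All using (All; []; _∷_)
  open import Data.Product using (∃-syntax; _,_; _×_)
  open import Algebra.Properties.CommutativeSemigroup *-commutativeSemigroup using (x∙yz≈y∙xz)
  open import Relation.Binary.PropositionalEquality
  open import Relation.Nullary using (Dec; yes; no)
  open import Relation.Nullary.Decidable using (toWitness)
  open import Relation.Nullary.Negation using (contradiction)
  open +-*-Solver

  -- x (x + 1) ⋯ (x + m), a product of m + 1 factors
  rising : ℕ → ℕ → ℕ
  rising x zero    = x
  rising x (suc m) = x * rising (suc x) m

  rising-suc : ∀ x m → rising x (suc m) ≡ rising x m * (x + suc m)
  rising-suc x zero    = cong (x *_) (+-comm 1 x)
  rising-suc x (suc m) = begin
    x * rising (suc x) (suc m)               ≡⟨ cong (x *_) (rising-suc (suc x) m) ⟩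
    x * (rising (suc x) m * (suc x + suc m)) ≡⟨ *-assoc x _ _ ⟨
    rising x (suc m) * (suc x + suc m)       ≡⟨ cong (rising x (suc m) *_) (+-suc x (suc m)) ⟨
    rising x (suc m) * (x + suc (suc m))     ∎
    where open ≡-Reasoning

  -- The two multiples (x + m + 1) D m! and x D m! of rising x (m + 1) differ by D (m + 1)!.
  rising∣*! : ∀ x m {D} → (∀ k → k ≤ m → x + k ∣ D) → rising x m ∣ D * m !
  rising∣*! x zero    {D} x+k∣D = subst₂ _∣_ (+-identityʳ x) (sym (*-identityʳ D)) (x+k∣D 0 z≤n)
  rising∣*! x (suc m) {D} x+k∣D =
    subst (rising x (suc m) ∣_) (reorder (suc m) D (m !)) (∣m+n∣m⇒∣n ∣[x+m+1]*A ∣x*A)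
    where
    A = D * m !
    ∣[x+m+1]*A : rising x (suc m) ∣ x * A + suc m * A
    ∣[x+m+1]*A = subst₂ _∣_ (sym (rising-suc x m)) (trans (*-comm A _) (*-distribʳ-+ A x (suc m)))
      (*-monoˡ-∣ (x + suc m) (rising∣*! x m (λ k k≤m → x+k∣D k (m≤n⇒m≤1+n k≤m))))
    ∣x*A : rising x (suc m) ∣ x * A
    ∣x*A = *-monoʳ-∣ x (rising∣*! (suc x) m λ k k≤m → subst (_∣ D) (+-suc x k) (x+k∣D (suc k) (s≤s k≤m)))
    reorder : ∀ a d f → a * (d * f) ≡ d * (a * f)
    reorder = solve 3 (λ a d f → a :* (d :* f) := d :* (a :* f)) refl

  2^m*m!≤rising : ∀ {x} m → m ≤ x → 0 < x → 2 ^ m * m ! ≤ rising x m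
  2^m*m!≤rising zero    _   0<x = 0<x
  2^m*m!≤rising {x} (suc m) m<x 0<x = begin
    2 ^ suc m * suc m !          ≡⟨ reorder (2 ^ m) (suc m) (m !) ⟩
    2 ^ m * m ! * (suc m + suc m) ≤⟨ *-mono-≤ (2^m*m!≤rising m (<⇒≤ m<x) 0<x) (+-monoˡ-≤ (suc m) m<x) ⟩
    rising x m * (x + suc m)     ≡⟨ rising-suc x m ⟨
    rising x (suc m)             ∎
    where
    open ≤-Reasoning
    reorder : ∀ t a f → 2 * t * (a * f) ≡ t * f * (a + a)
    reorder = solve 3 (λ t a f → con 2 :* t :* (a :* f) := t :* f :* (a :+ a)) refl

  ∣n! : ∀ {k n} → 0 < k → k ≤ n → k ∣ n !
  ∣n! {suc k} _ k≤n = ∣-trans (m∣m*n (k !)) (m≤n⇒m!∣n! k≤n)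

  prime⇒>1 : ∀ {p} → Prime p → 1 < p
  prime⇒>1 {p} pp = nonTrivial⇒n>1 p {{prime⇒nonTrivial pp}}

  module _ {M s B : ℕ} (B≤s*s : B ≤ s * s) (primes∣M : ∀ p → Prime p → p < B → p ∣ M) where

    -- A product of primes below s * s has at most one prime factor exceeding s.
    productOfPrimes∣ : ∀ j {qs} → All Prime qs → product qs < B → product qs < 2 ^ j →
                       product qs ∣ M * (s !) ^ j
    productOfPrimes∣ j       {[]}     _         _     _     = 1∣ _
    productOfPrimes∣ zero    {q ∷ qs} ps        _     q*r<1 = contradiction q*r<1 (≤⇒≯ (productOfPrimes≥1 ps))
    productOfPrimes∣ (suc j) {q ∷ qs} (pq ∷ ps) q*r<B q*r<2^[1+j] = byCases (q ≤? s)
      where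
      r = product qs
      0<r : 0 < r
      0<r = productOfPrimes≥1 ps
      1<q : 1 < q
      1<q = prime⇒>1 pq
      instance
        _ : NonZero q
        _ = >-nonZero (<⇒≤ 1<q)
        _ : NonZero r
        _ = >-nonZero 0<r
      byCases : Dec (q ≤ s) → q * r ∣ M * (s !) ^ suc j
      byCases (yes q≤s) = subst (q * r ∣_) (x∙yz≈y∙xz (s !) M _) (*-pres-∣ (∣n! (<⇒≤ 1<q) q≤s) r∣M*s!^j)
        where
        r∣M*s!^j : r ∣ M * (s !) ^ j
        r∣M*s!^j = productOfPrimes∣ j ps (≤-<-trans (m≤n*m r q) q*r<B)
          (*-cancelˡ-< 2 r (2 ^ j) (≤-<-trans (*-monoˡ-≤ r 1<q) q*r<2^[1+j]))
      byCases (no q≰s) = *-pres-∣ q∣M (∣-trans (∣n! 0<r r≤s) (m∣m*n ((s !) ^ j)))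
        where
        q∣M : q ∣ M
        q∣M = primes∣M q pq (≤-<-trans (m≤m*n q r) q*r<B)
        r≤s : r ≤ s
        r≤s with r ≤? s
        ... | yes r≤s = r≤s
        ... | no r≰s = contradiction (≤-trans (*-mono-< (≰⇒> q≰s) (≰⇒> r≰s)) (<⇒≤ q*r<B)) (≤⇒≯ B≤s*s)

    ∣M*s!^j : ∀ j {k} → B ≤ 2 ^ j → 0 < k → k < B → k ∣ M * (s !) ^ j
    ∣M*s!^j j B≤2^j 0<k k<B = subst (_∣ M * (s !) ^ j) (sym isFactorisation)
      (productOfPrimes∣ j factorsPrime (subst (_< B) isFactorisation k<B)
        (subst (_< 2 ^ j) isFactorisation (<-≤-trans k<B B≤2^j)))
      where open PrimeFactorisation (factorise _ {{>-nonZero 0<k}})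

    2^m≤M*s!^j : ∀ j m → B ≤ 2 ^ j → 0 < M → 0 < m → m + m < B → 2 ^ m ≤ M * (s !) ^ j
    2^m≤M*s!^j j m B≤2^j 0<M 0<m m+m<B = *-cancelʳ-≤ (2 ^ m) D (m !) {{m !≢0}} (begin
      2 ^ m * m !  ≤⟨ 2^m*m!≤rising m ≤-refl 0<m ⟩
      rising m m   ≤⟨ ∣⇒≤ {{>-nonZero (*-mono-≤ 0<D (1≤n! m))}} (rising∣*! m m m+k∣D) ⟩
      D * m !      ∎)
      where
      open ≤-Reasoning
      D = M * (s !) ^ j
      0<D : 0 < D
      0<D = *-mono-≤ 0<M (m^n>0 (s !) {{s !≢0}} j)
      m+k∣D : ∀ k → k ≤ m → m + k ∣ D
      m+k∣D k k≤m = ∣M*s!^j j B≤2^j (<-≤-trans 0<m (m≤m+n m k)) (≤-<-trans (+-monoʳ-≤ m k≤m) m+m<B)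

  k!≤n^k : ∀ {k n} → k ≤ n → k ! ≤ n ^ k
  k!≤n^k {zero}  _   = ≤-refl
  k!≤n^k {suc k} k<n = *-mono-≤ k<n (k!≤n^k (<⇒≤ k<n))

  8*[2+g]²≤2^g : ∀ g → 11 ≤ g → 8 * ((2 + g) * (2 + g)) ≤ 2 ^ g
  8*[2+g]²≤2^g g 11≤g = subst (λ g → 8 * ((2 + g) * (2 + g)) ≤ 2 ^ g) (m+[n∸m]≡n 11≤g) (from11 (g ∸ 11))
    where
    from11 : ∀ t → 8 * ((13 + t) * (13 + t)) ≤ 2 ^ (11 + t)
    from11 zero    = toWitness {a? = 8 * (13 * 13) ≤? 2 ^ 11} _
    from11 (suc t) = begin
      8 * ((14 + t) * (14 + t))                                   ≤⟨ m≤m+n _ _ ⟩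
      8 * ((14 + t) * (14 + t)) + 8 * (t * t + 24 * t + 142)      ≡⟨ doubling t ⟩
      2 * (8 * ((13 + t) * (13 + t)))                             ≤⟨ *-monoʳ-≤ 2 (from11 t) ⟩
      2 * 2 ^ (11 + t)                                            ∎
      where
      open ≤-Reasoning
      doubling : ∀ t → 8 * ((14 + t) * (14 + t)) + 8 * (t * t + 24 * t + 142)
                       ≡ 2 * (8 * ((13 + t) * (13 + t)))
      doubling = solve 1 (λ t → con 8 :* ((con 14 :+ t) :* (con 14 :+ t))
                                  :+ con 8 :* (t :* t :+ con 24 :* t :+ con 142)
                              := con 2 :* (con 8 :* ((con 13 :+ t) :* (con 13 :+ t)))) refl

  -- Take s = 2^(g+2) and m = 2^(g+g+1) in 2^m ≤ M (s!)^n; then (s!)^n ≤ 2^B with B ≤ m / 2.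
  2^2^[g+g]≤M : ∀ {M n} g → 11 ≤ g → 3 + (g + g) ≤ n → n ≤ 4 + (g + g) → 0 < M →
                (∀ p → Prime p → p < 2 ^ n → p ∣ M) → 2 ^ 2 ^ (g + g) ≤ M
  2^2^[g+g]≤M {M} {n} g 11≤g lo hi 0<M primes∣M = *-cancelʳ-≤ (2 ^ K) M (2 ^ B) {{m^n≢0 2 B}} (begin
    2 ^ K * 2 ^ B  ≤⟨ *-monoʳ-≤ (2 ^ K) (^-monoʳ-≤ 2 B≤K) ⟩
    2 ^ K * 2 ^ K  ≡⟨ ^-distribˡ-+-* 2 K K ⟨
    2 ^ (K + K)    ≤⟨ 2^m≤M*s!^j {s = s} 2^n≤s*s primes∣M n (K + K) ≤-refl 0<M 0<K+K 4K<2^n ⟩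
    M * (s !) ^ n  ≤⟨ *-monoʳ-≤ M s!^n≤2^B ⟩
    M * 2 ^ B      ∎)
    where
    open ≤-Reasoning
    s = 2 ^ (2 + g)
    K = 2 ^ (g + g)
    B = (2 + g) * s * n
    0<K+K : 0 < K + K
    0<K+K = ≤-trans (m^n>0 2 (g + g)) (m≤m+n K K)
    2^n≤s*s : 2 ^ n ≤ s * s
    2^n≤s*s = begin
      2 ^ n                    ≤⟨ ^-monoʳ-≤ 2 hi ⟩
      2 ^ (4 + (g + g))        ≡⟨ cong (2 ^_) (4+[g+g]≡[2+g]+[2+g] g) ⟩
      2 ^ ((2 + g) + (2 + g))  ≡⟨ ^-distribˡ-+-* 2 (2 + g) (2 + g) ⟩
      s * s                    ∎
      where
      4+[g+g]≡[2+g]+[2+g] : ∀ g → 4 + (g + g) ≡ (2 + g) + (2 + g)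
      4+[g+g]≡[2+g]+[2+g] = solve 1 (λ g → con 4 :+ (g :+ g) := (con 2 :+ g) :+ (con 2 :+ g)) refl
    4K<2^n : (K + K) + (K + K) < 2 ^ n
    4K<2^n = begin-strict
      (K + K) + (K + K)  ≡⟨ solve 1 (λ K → (K :+ K) :+ (K :+ K) := con 2 :* (con 2 :* K)) refl K ⟩
      2 ^ (2 + (g + g))  <⟨ ^-monoʳ-< 2 ≤-refl {2 + (g + g)} ≤-refl ⟩
      2 ^ (3 + (g + g))  ≤⟨ ^-monoʳ-≤ 2 lo ⟩
      2 ^ n              ∎
    s!^n≤2^B : (s !) ^ n ≤ 2 ^ B
    s!^n≤2^B = begin
      (s !) ^ n              ≤⟨ ^-monoˡ-≤ n (k!≤n^k {s} ≤-refl) ⟩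
      (s ^ s) ^ n            ≡⟨ cong (_^ n) (^-*-assoc 2 (2 + g) s) ⟩
      (2 ^ ((2 + g) * s)) ^ n ≡⟨ ^-*-assoc 2 ((2 + g) * s) n ⟩
      2 ^ B                  ∎
    B≤K : B ≤ K
    B≤K = begin
      (2 + g) * s * n                          ≤⟨ *-monoʳ-≤ ((2 + g) * s) hi ⟩
      (2 + g) * s * (4 + (g + g))              ≡⟨ regroup g (2 ^ g) ⟩
      8 * ((2 + g) * (2 + g)) * 2 ^ g          ≤⟨ *-monoˡ-≤ (2 ^ g) (8*[2+g]²≤2^g g 11≤g) ⟩
      2 ^ g * 2 ^ g                            ≡⟨ ^-distribˡ-+-* 2 g g ⟨
      K                                        ∎
      where
      regroup : ∀ g G → (2 + g) * (2 * (2 * G)) * (4 + (g + g)) ≡ 8 * ((2 + g) * (2 + g)) * G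
      regroup = solve 2 (λ g G → (con 2 :+ g) :* (con 2 :* (con 2 :* G)) :* (con 4 :+ (g :+ g))
                              := con 8 :* ((con 2 :+ g) :* (con 2 :+ g)) :* G) refl

  halving : ∀ n → ∃[ h ] h + h ≤ n × n ≤ suc (h + h)
  halving zero          = 0 , z≤n , z≤n
  halving (suc zero)    = 0 , z≤n , s≤s z≤n
  halving (suc (suc n)) with halving n
  ... | h , lo , hi = suc h , s≤s (subst (_≤ suc n) (sym (+-suc h h)) (s≤s lo))
                            , s≤s (s≤s (subst (n ≤_) (sym (+-suc h h)) hi))

  2^2^[n∸4]≤M : ∀ {M} n → 25 ≤ n → 0 < M → (∀ p → Prime p → p < 2 ^ n → p ∣ M) → 2 ^ 2 ^ (n ∸ 4) ≤ M
  2^2^[n∸4]≤M (suc (suc (suc n))) (s≤s (s≤s (s≤s 22≤n))) 0<M primes∣M with halving n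
  ... | h , lo , hi = ≤-trans (^-monoʳ-≤ 2 (^-monoʳ-≤ 2 (∸-monoˡ-≤ 1 hi)))
                              (2^2^[g+g]≤M h 11≤h (s≤s (s≤s (s≤s lo))) (s≤s (s≤s (s≤s hi))) 0<M primes∣M)
    where
    11≤h : 11 ≤ h
    11≤h with 11 ≤? h
    ... | yes 11≤h = 11≤h
    ... | no 11≰h = contradiction (≤-trans 22≤n hi) (<⇒≱ (s≤s (s≤s (+-mono-≤ h≤10 h≤10))))
      where h≤10 = ≤-pred (≰⇒> 11≰h)

module Evaluation where

  open import Data.Nat as ℕ using (ℕ; zero; suc; _<_; _≤_; _^_; s≤s)
  import Data.Nat.Properties as ℕ
  open import Data.Nat.DivMod using (_/_; _%_; m≡m%n+[m/n]*n; m%n<n; m<n*o⇒m/o<n)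
  open import Data.Nat.ListAction using (sum)
  open import Data.Nat.Logarithm using (⌈log₂_⌉)
  open import Data.Integer as ℤ using (ℤ; +_; 0ℤ; 1ℤ; -1ℤ; _+_; _*_)
  import Data.Integer.Properties as ℤ
  open import Data.Integer.Divisibility.Signed using (_∣_; divides; ∣-reflexive; ∣m∣n⇒∣m+n; ∣n⇒∣m*n)
  open import Data.Integer.Tactic.RingSolver using (solve-∀)
  open import Data.Fin as Fin using (Fin; zero; suc; toℕ; splitAt)
  import Data.Fin.Properties as Fin
  open import Data.Vec using ([]; _∷_; lookup; zipWith; updateAt)
  open import Data.List using (List; []; _∷_; _++_; map; concatMap; deduplicate; tabulate; allFin)
  import Data.List.Properties as List
  open import Data.List.Membership.Propositional using (_∈_)
  open import Data.List.Membership.Propositional.Properties using (∈-map⁺; ∈-++⁺ˡ; ∈-++⁺ʳ; ∈-deduplicate⁺)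
  open import Data.List.Relation.Unary.All as All using (All; []; _∷_)
  import Data.List.Relation.Unary.All.Properties as All
  open import Data.List.Relation.Unary.Any using (here; there)
  open import Data.List.Relation.Unary.AllPairs using (AllPairs; []; _∷_)
  open import Data.List.Relation.Unary.Unique.DecPropositional.Properties using (deduplicate-!)
  open import Data.Product using (_×_; _,_; proj₁; proj₂)
  open import Data.Sum using (_⊎_; inj₁; inj₂; [_,_]′)
  open import Data.Bool using (if_then_else_)
  open import Data.Empty using (⊥-elim)
  open import Function using (_∘_; id)
  open import Relation.Nullary using (does; yes; no)
  open import Relation.Binary.PropositionalEquality

  evalMono : ∀ {N} → (Fin N → ℤ) → Monomial N → ℤ
  evalMono ρ []      = 1ℤ
  evalMono ρ (e ∷ m) = ρ zero ℤ.^ e * evalMono (ρ ∘ Fin.suc) m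

  eval : ∀ {N} → (Fin N → ℤ) → Terms N → ℤ
  eval ρ []            = 0ℤ
  eval ρ ((a , m) ∷ p) = a * evalMono ρ m + eval ρ p

  evalMono-one : ∀ {N} (ρ : Fin N → ℤ) → evalMono ρ one ≡ 1ℤ
  evalMono-one {zero}  ρ = refl
  evalMono-one {suc N} ρ = trans (ℤ.*-identityˡ _) (evalMono-one (ρ ∘ Fin.suc))

  evalMono-var : ∀ {N} (ρ : Fin N → ℤ) i → evalMono ρ (var i) ≡ ρ i
  evalMono-var {suc N} ρ zero    = trans (cong (ρ zero * 1ℤ *_) (evalMono-one (ρ ∘ Fin.suc))) (lemma (ρ zero))
    where
    lemma : ∀ x → x * 1ℤ * 1ℤ ≡ x
    lemma = solve-∀
  evalMono-var {suc N} ρ (suc i) = trans (ℤ.*-identityˡ _) (evalMono-var (ρ ∘ Fin.suc) i)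

  evalMono-var² : ∀ {N} (ρ : Fin N → ℤ) i → evalMono ρ (updateAt one i (λ _ → 2)) ≡ ρ i * ρ i
  evalMono-var² {suc N} ρ zero    =
    trans (cong (ρ zero * (ρ zero * 1ℤ) *_) (evalMono-one (ρ ∘ Fin.suc))) (lemma (ρ zero))
    where
    lemma : ∀ x → x * (x * 1ℤ) * 1ℤ ≡ x * x
    lemma = solve-∀
  evalMono-var² {suc N} ρ (suc i) = trans (ℤ.*-identityˡ _) (evalMono-var² (ρ ∘ Fin.suc) i)

  evalMono-mulVar : ∀ {N} (ρ : Fin N → ℤ) m i → evalMono ρ (updateAt m i suc) ≡ ρ i * evalMono ρ m
  evalMono-mulVar ρ (e ∷ m) zero    = ℤ.*-assoc (ρ zero) (ρ zero ℤ.^ e) (evalMono (ρ ∘ Fin.suc) m)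
  evalMono-mulVar ρ (e ∷ m) (suc i) = trans (cong (ρ zero ℤ.^ e *_) (evalMono-mulVar (ρ ∘ Fin.suc) m i))
    (lemma (ρ zero ℤ.^ e) (ρ (suc i)) (evalMono (ρ ∘ Fin.suc) m))
    where
    lemma : ∀ a b c → a * (b * c) ≡ b * (a * c)
    lemma = solve-∀

  evalMono-zipWith : ∀ {N} (ρ : Fin N → ℤ) m m' → evalMono ρ (zipWith ℕ._+_ m m') ≡ evalMono ρ m * evalMono ρ m'
  evalMono-zipWith ρ []      []        = refl
  evalMono-zipWith ρ (e ∷ m) (e' ∷ m') =
    trans (cong₂ _*_ (ℤ.^-distribˡ-+-* (ρ zero) e e') (evalMono-zipWith (ρ ∘ Fin.suc) m m'))
          (lemma (ρ zero ℤ.^ e) (ρ zero ℤ.^ e') (evalMono (ρ ∘ Fin.suc) m) (evalMono (ρ ∘ Fin.suc) m'))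
    where
    lemma : ∀ a b c d → a * b * (c * d) ≡ a * c * (b * d)
    lemma = solve-∀

  evalMono-local : ∀ {N} (ρ ρ' : Fin N → ℤ) m → (∀ i → lookup m i ≡ 0 ⊎ ρ i ≡ ρ' i) →
                   evalMono ρ m ≡ evalMono ρ' m
  evalMono-local ρ ρ' []      _     = refl
  evalMono-local ρ ρ' (e ∷ m) agree =
    cong₂ _*_ head (evalMono-local (ρ ∘ Fin.suc) (ρ' ∘ Fin.suc) m (agree ∘ Fin.suc))
    where
    head : ρ zero ℤ.^ e ≡ ρ' zero ℤ.^ e
    head with agree zero
    ... | inj₁ refl = refl
    ... | inj₂ ρ₀≡ρ'₀ = cong (ℤ._^ e) ρ₀≡ρ'₀

  module _ {N : ℕ} (ρ : Fin N → ℤ) where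

    eval-++ : ∀ p q → eval ρ (p ++ q) ≡ eval ρ p + eval ρ q
    eval-++ []            q = sym (ℤ.+-identityˡ _)
    eval-++ ((a , m) ∷ p) q =
      trans (cong (_+_ (a * evalMono ρ m)) (eval-++ p q)) (sym (ℤ.+-assoc (a * evalMono ρ m) (eval ρ p) (eval ρ q)))

    eval-scale : ∀ α p → eval ρ (scale α p) ≡ α * eval ρ p
    eval-scale α []            = sym (ℤ.*-zeroʳ α)
    eval-scale α ((a , m) ∷ p) = trans (cong (_+_ (α * a * evalMono ρ m)) (eval-scale α p)) (lemma α a _ _)
      where
      lemma : ∀ α a v e → α * a * v + α * e ≡ α * (a * v + e)
      lemma = solve-∀

    eval-lincomb : ∀ α p β q → eval ρ (lincomb α p β q) ≡ α * eval ρ p + β * eval ρ q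
    eval-lincomb α p β q = trans (eval-++ (scale α p) (scale β q)) (cong₂ _+_ (eval-scale α p) (eval-scale β q))

    eval-mulVar : ∀ i p → eval ρ (mulVar i p) ≡ ρ i * eval ρ p
    eval-mulVar i []            = sym (ℤ.*-zeroʳ (ρ i))
    eval-mulVar i ((a , m) ∷ p) =
      trans (cong₂ (λ v e → a * v + e) (evalMono-mulVar ρ m i) (eval-mulVar i p)) (lemma a (ρ i) _ _)
      where
      lemma : ∀ a r v e → a * (r * v) + r * e ≡ r * (a * v + e)
      lemma = solve-∀

    eval-const : ∀ M → eval ρ (const M) ≡ M
    eval-const M = trans (cong (λ v → M * v + 0ℤ) (evalMono-one ρ)) (trans (ℤ.+-identityʳ _) (ℤ.*-identityʳ M))

    private
      mulTerm : ℤ × Monomial N → ℤ × Monomial N → ℤ × Monomial N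
      mulTerm (a , m) (b , m') = (a * b , zipWith ℕ._+_ m m')

      eval-map-mulTerm : ∀ a m p → eval ρ (map (mulTerm (a , m)) p) ≡ a * evalMono ρ m * eval ρ p
      eval-map-mulTerm a m []             = sym (ℤ.*-zeroʳ (a * evalMono ρ m))
      eval-map-mulTerm a m ((b , m') ∷ p) =
        trans (cong₂ (λ v e → a * b * v + e) (evalMono-zipWith ρ m m') (eval-map-mulTerm a m p)) (lemma a b _ _ _)
        where
        lemma : ∀ a b v w e → a * b * (v * w) + a * v * e ≡ a * v * (b * w + e)
        lemma = solve-∀

      eval-concatMap-mulTerm : ∀ q p → eval ρ (concatMap (λ t → map (mulTerm t) p) q) ≡ eval ρ q * eval ρ p
      eval-concatMap-mulTerm []            p = sym (ℤ.*-zeroˡ (eval ρ p))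
      eval-concatMap-mulTerm ((a , m) ∷ q) p = begin
        eval ρ (map (mulTerm (a , m)) p ++ concatMap (λ t → map (mulTerm t) p) q)
          ≡⟨ eval-++ (map (mulTerm (a , m)) p) _ ⟩
        eval ρ (map (mulTerm (a , m)) p) + eval ρ (concatMap (λ t → map (mulTerm t) p) q)
          ≡⟨ cong₂ _+_ (eval-map-mulTerm a m p) (eval-concatMap-mulTerm q p) ⟩
        a * evalMono ρ m * eval ρ p + eval ρ q * eval ρ p
          ≡⟨ ℤ.*-distribʳ-+ (eval ρ p) (a * evalMono ρ m) (eval ρ q) ⟨
        (a * evalMono ρ m + eval ρ q) * eval ρ p
          ∎
        where open ≡-Reasoning

    eval-square : ∀ p → eval ρ (square p) ≡ eval ρ p * eval ρ p
    eval-square p = trans (cong (eval ρ) square≡) (eval-concatMap-mulTerm p p)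
      where
      square≡ : square p ≡ concatMap (λ t → map (mulTerm t) p) p
      square≡ = List.concatMap-cong (λ _ → List.map-cong (λ _ → refl) p) p

  coeffTerm : ∀ {N} → Monomial N → ℤ → Monomial N → ℤ
  coeffTerm m a d = if does (m ≟ₘ d) then a else + 0

  coeffTerm-self : ∀ {N} (m : Monomial N) a → coeffTerm m a m ≡ a
  coeffTerm-self m a with m ≟ₘ m
  ... | yes _   = refl
  ... | no m≢m = ⊥-elim (m≢m refl)

  coeffTerm-≢ : ∀ {N} {m d : Monomial N} a → m ≢ d → coeffTerm m a d ≡ + 0
  coeffTerm-≢ {m = m} {d} a m≢d with m ≟ₘ d
  ... | yes m≡d = ⊥-elim (m≢d m≡d)
  ... | no _    = refl

  sumOver : ∀ {N} → List (Monomial N) → (Monomial N → ℤ) → ℤ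
  sumOver []       f = 0ℤ
  sumOver (d ∷ ds) f = f d + sumOver ds f

  sumOver-cong : ∀ {N} (ds : List (Monomial N)) {f g} → (∀ d → f d ≡ g d) → sumOver ds f ≡ sumOver ds g
  sumOver-cong []       f≡g = refl
  sumOver-cong (d ∷ ds) f≡g = cong₂ _+_ (f≡g d) (sumOver-cong ds f≡g)

  sumOver-+ : ∀ {N} (ds : List (Monomial N)) f g → sumOver ds (λ d → f d + g d) ≡ sumOver ds f + sumOver ds g
  sumOver-+ []       f g = refl
  sumOver-+ (d ∷ ds) f g = trans (cong (_+_ (f d + g d)) (sumOver-+ ds f g)) (lemma (f d) (g d) _ _)
    where
    lemma : ∀ a b c e → a + b + (c + e) ≡ a + c + (b + e)
    lemma = solve-∀

  sumOver-zero : ∀ {N} {ds : List (Monomial N)} {f} → All (λ d → f d ≡ 0ℤ) ds → sumOver ds f ≡ 0ℤ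
  sumOver-zero []           = refl
  sumOver-zero (f≡0 ∷ f≡0s) = cong₂ _+_ f≡0 (sumOver-zero f≡0s)

  module _ {N : ℕ} (v : Monomial N → ℤ) where

    sumOver-coeffTerm-∉ : ∀ {ds} m a → All (m ≢_) ds → sumOver ds (λ d → coeffTerm m a d * v d) ≡ 0ℤ
    sumOver-coeffTerm-∉ m a m∉ds =
      sumOver-zero (All.map (λ {d} m≢d → trans (cong (_* v d) (coeffTerm-≢ a m≢d)) (ℤ.*-zeroˡ (v d))) m∉ds)

    sumOver-coeffTerm-∈ : ∀ {ds} m a → m ∈ ds → AllPairs _≢_ ds →
                          sumOver ds (λ d → coeffTerm m a d * v d) ≡ a * v m
    sumOver-coeffTerm-∈ m a (here refl) (m∉ds ∷ _) =
      trans (cong₂ _+_ (cong (_* v m) (coeffTerm-self m a)) (sumOver-coeffTerm-∉ m a m∉ds)) (ℤ.+-identityʳ _)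
    sumOver-coeffTerm-∈ {d ∷ _} m a (there m∈ds) (d∉ds ∷ distinct) =
      trans (cong₂ _+_ (trans (cong (_* v d) (coeffTerm-≢ a m≢d)) (ℤ.*-zeroˡ (v d)))
                       (sumOver-coeffTerm-∈ m a m∈ds distinct))
            (ℤ.+-identityˡ _)
      where
      m≢d : m ≢ d
      m≢d m≡d = All.lookup d∉ds m∈ds (sym m≡d)

  module _ {N : ℕ} (ρ : Fin N → ℤ) where

    eval≡sumOver : ∀ {ds} → AllPairs _≢_ ds → ∀ p → All (λ t → proj₂ t ∈ ds) p →
                   eval ρ p ≡ sumOver ds (λ d → coeff p d * evalMono ρ d)
    eval≡sumOver {ds} distinct []            _            =
      sym (sumOver-zero {ds = ds} (All.tabulate (λ {d} _ → ℤ.*-zeroˡ (evalMono ρ d))))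
    eval≡sumOver {ds} distinct ((a , m) ∷ p) (m∈ds ∷ p⊆ds) = begin
      a * evalMono ρ m + eval ρ p
        ≡⟨ cong₂ _+_ (sym (sumOver-coeffTerm-∈ (evalMono ρ) m a m∈ds distinct)) (eval≡sumOver distinct p p⊆ds) ⟩
      sumOver ds (λ d → coeffTerm m a d * evalMono ρ d) + sumOver ds (λ d → coeff p d * evalMono ρ d)
        ≡⟨ sumOver-+ ds _ _ ⟨
      sumOver ds (λ d → coeffTerm m a d * evalMono ρ d + coeff p d * evalMono ρ d)
        ≡⟨ sumOver-cong ds (λ d → ℤ.*-distribʳ-+ (evalMono ρ d) (coeffTerm m a d) (coeff p d)) ⟨
      sumOver ds (λ d → coeff ((a , m) ∷ p) d * evalMono ρ d)
        ∎
      where open ≡-Reasoning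

    -- Both sides regroup as a sum over the monomials occurring in p or q, each taken once.
    eval-resp-≈ : ∀ p q → p ≈ q → eval ρ p ≡ eval ρ q
    eval-resp-≈ p q p≈q = begin
      eval ρ p                                     ≡⟨ eval≡sumOver distinct p
                                                         (All.tabulate (∈ds ∘ ∈-++⁺ˡ ∘ ∈-map⁺ proj₂)) ⟩
      sumOver ds (λ d → coeff p d * evalMono ρ d)  ≡⟨ sumOver-cong ds (λ d → cong (_* evalMono ρ d) (p≈q d)) ⟩
      sumOver ds (λ d → coeff q d * evalMono ρ d)  ≡⟨ eval≡sumOver distinct q
                                                         (All.tabulate (∈ds ∘ ∈-++⁺ʳ _ ∘ ∈-map⁺ proj₂)) ⟨
      eval ρ q                                     ∎
      where
      open ≡-Reasoning
      ds = deduplicate _≟ₘ_ (map proj₂ p ++ map proj₂ q)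
      distinct : AllPairs _≢_ ds
      distinct = deduplicate-! _≟ₘ_ (map proj₂ p ++ map proj₂ q)
      ∈ds : ∀ {m} → m ∈ map proj₂ p ++ map proj₂ q → m ∈ ds
      ∈ds = ∈-deduplicate⁺ _≟ₘ_

  eval-local : ∀ {N} (ρ ρ' : Fin N → ℤ) p → All (λ t → ∀ i → lookup (proj₂ t) i ≡ 0 ⊎ ρ i ≡ ρ' i) p →
               eval ρ p ≡ eval ρ' p
  eval-local ρ ρ' []            []               = refl
  eval-local ρ ρ' ((a , m) ∷ p) (agree ∷ agrees) =
    cong₂ (λ v e → a * v + e) (evalMono-local ρ ρ' m agree) (eval-local ρ ρ' p agrees)

  eval-tabulate : ∀ {N n} (ρ : Fin N → ℤ) (t : Fin n → ℤ × Monomial N) (g : Fin n → ℕ) →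
                  (∀ i → proj₁ (t i) * evalMono ρ (proj₂ (t i)) ≡ + g i) →
                  eval ρ (tabulate t) ≡ + sum (tabulate g)
  eval-tabulate {n = zero}  ρ t g t≡g = refl
  eval-tabulate {n = suc n} ρ t g t≡g =
    cong₂ _+_ (t≡g zero) (eval-tabulate ρ (t ∘ Fin.suc) (g ∘ Fin.suc) (t≡g ∘ Fin.suc))

  -- Soundness modulo a squarefree integer

  module _ {N} {Γ : List (Terms N)} (ρ : Fin N → ℤ) {q : ℤ} (squarefree : ∀ z → q ∣ z * z → q ∣ z)
           (axioms∣ : All (λ g → q ∣ eval ρ g) Γ) where

    rule-∣ : ∀ {prev p} → Rule Γ prev p → All (λ l → q ∣ eval ρ l) prev → q ∣ eval ρ p
    rule-∣ {p = p} (axiom p∈Γ) _ =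
      All.lookupWith (λ {g} g∣ p≈g → subst (q ∣_) (sym (eval-resp-≈ ρ p g p≈g)) g∣) axioms∣ p∈Γ
    rule-∣ {p = p} (lin α β r r' r∈ r'∈ p≈) prev∣ =
      subst (q ∣_) (sym (trans (eval-resp-≈ ρ p (lincomb α r β r') p≈) (eval-lincomb ρ α r β r')))
        (∣m∣n⇒∣m+n (∣n⇒∣m*n α (All.lookup prev∣ r∈)) (∣n⇒∣m*n β (All.lookup prev∣ r'∈)))
    rule-∣ {p = p} (mulV i r r∈ p≈) prev∣ =
      subst (q ∣_) (sym (trans (eval-resp-≈ ρ p (mulVar i r) p≈) (eval-mulVar ρ i r)))
        (∣n⇒∣m*n (ρ i) (All.lookup prev∣ r∈))
    rule-∣ {p = p} (sqrtR r r∈ p²≈r) prev∣ =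
      squarefree (eval ρ p) (subst (q ∣_) (trans (sym (eval-resp-≈ ρ (square p) r p²≈r)) (eval-square ρ p))
        (All.lookup prev∣ r∈))

    deriv-∣ : ∀ {ls} → Deriv Γ ls → All (λ l → q ∣ eval ρ l) ls
    deriv-∣ []             = []
    deriv-∣ (step d _ rule) = let prev∣ = deriv-∣ d in rule-∣ rule prev∣ ∷ prev∣

    refutation-∣ : (π : Refutation Γ) → q ∣ Refutation.M π
    refutation-∣ π =
      subst (q ∣_) (trans (eval-resp-≈ ρ last (const M) last≈M) (eval-const ρ M)) (All.head (deriv-∣ deriv))
      where open Refutation π

  -- The final constant is a coefficient of the last line

  coeff-∉ : ∀ {N} {d : Monomial N} ts → All (λ t → proj₂ t ≢ d) ts → coeff ts d ≡ 0ℤ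
  coeff-∉ []       []               = refl
  coeff-∉ ((a , m) ∷ ts) (m≢d ∷ ts∌d) = cong₂ _+_ (coeffTerm-≢ a m≢d) (coeff-∉ ts ts∌d)

  coeff-∈ : ∀ {N} {d : Monomial N} ts → Canonical ts → coeff ts d ≢ 0ℤ → (coeff ts d , d) ∈ ts
  coeff-∈ []             _ c≢0 = ⊥-elim (c≢0 refl)
  coeff-∈ {d = d} ((a , m) ∷ ts) (m∉ts ∷ distinct , _ ∷ nonzero) c≢0 with m ≟ₘ d
  ... | yes refl =
    here (cong (_, m) (trans (cong (_+_ a) (coeff-∉ ts (All.map (_∘ sym) (All.map⁻ m∉ts)))) (ℤ.+-identityʳ a)))
  ... | no _     = there (subst (λ c → (c , _) ∈ ts) (sym (ℤ.+-identityˡ _))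
                                (coeff-∈ ts (distinct , nonzero) (c≢0 ∘ trans (ℤ.+-identityˡ _))))

  sum-map-∈ : ∀ {A : Set} (f : A → ℕ) {x xs} → x ∈ xs → f x ≤ sum (map f xs)
  sum-map-∈ f {xs = x ∷ xs} (here refl) = ℕ.m≤m+n (f x) _
  sum-map-∈ f {xs = y ∷ xs} (there x∈xs) = ℕ.≤-trans (sum-map-∈ f x∈xs) (ℕ.m≤n+m _ (f y))

  head-canonical : ∀ {N} {Γ : List (Terms N)} {p ps} → Deriv Γ (p ∷ ps) → Canonical p
  head-canonical (step _ canonical _) = canonical

  log₂∣M∣≤size : ∀ {N} {Γ : List (Terms N)} (π : Refutation Γ) →
                 ⌈log₂ ℤ.∣ Refutation.M π ∣ ⌉ ≤ Refutation.size π
  log₂∣M∣≤size {N} π =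
    ℕ.≤-trans (sum-map-∈ (λ t → ⌈log₂ ℤ.∣ proj₁ t ∣ ⌉) M∈last) (sum-map-∈ polySize {xs = last ∷ rest} (here refl))
    where
    open Refutation π
    coeff-last : coeff last one ≡ M
    coeff-last = trans (last≈M one) (trans (cong (_+ 0ℤ) (coeffTerm-self (one {N}) M)) (ℤ.+-identityʳ M))
    M∈last : (M , one) ∈ last
    M∈last = subst (λ c → (c , one) ∈ last) coeff-last
      (coeff-∈ last (head-canonical deriv) (M≢0 ∘ trans (sym coeff-last)))

  -- Binary digits and the point they define

  bit : ℕ → ℕ → ℕ
  bit k zero    = k % 2
  bit k (suc i) = bit (k / 2) i

  bit≤1 : ∀ k i → bit k i ≤ 1
  bit≤1 k zero    = ℕ.≤-pred (m%n<n k 2)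
  bit≤1 k (suc i) = bit≤1 (k / 2) i

  sum-tabulate-2* : ∀ {n} (f : Fin n → ℕ) → sum (tabulate (λ i → 2 ℕ.* f i)) ≡ 2 ℕ.* sum (tabulate f)
  sum-tabulate-2* {zero}  f = refl
  sum-tabulate-2* {suc n} f =
    trans (cong (2 ℕ.* f Fin.zero ℕ.+_) (sum-tabulate-2* (f ∘ Fin.suc)))
          (sym (ℕ.*-distribˡ-+ 2 (f Fin.zero) (sum (tabulate (f ∘ Fin.suc)))))

  binaryExpansion : ∀ n k → k < 2 ^ n → sum (tabulate {n = n} (λ i → 2 ^ toℕ i ℕ.* bit k (toℕ i))) ≡ k
  binaryExpansion zero    zero    _       = refl
  binaryExpansion zero    (suc k) (s≤s ())
  binaryExpansion (suc n) k       k<2^1+n = begin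
    1 ℕ.* (k % 2) ℕ.+ sum (tabulate {n = n} (λ i → 2 ℕ.* 2 ^ toℕ i ℕ.* bit (k / 2) (toℕ i)))
      ≡⟨ cong₂ ℕ._+_ (ℕ.*-identityˡ (k % 2))
           (trans (cong sum (List.tabulate-cong {n = n} (λ i → ℕ.*-assoc 2 (2 ^ toℕ i) (bit (k / 2) (toℕ i)))))
                  (sum-tabulate-2* {n} (λ i → 2 ^ toℕ i ℕ.* bit (k / 2) (toℕ i)))) ⟩
    k % 2 ℕ.+ 2 ℕ.* sum (tabulate {n = n} (λ i → 2 ^ toℕ i ℕ.* bit (k / 2) (toℕ i)))
      ≡⟨ cong (λ s → k % 2 ℕ.+ 2 ℕ.* s)
              (binaryExpansion n (k / 2) (m<n*o⇒m/o<n (subst (k <_) (ℕ.*-comm 2 (2 ^ n)) k<2^1+n))) ⟩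
    k % 2 ℕ.+ 2 ℕ.* (k / 2)
      ≡⟨ cong (k % 2 ℕ.+_) (ℕ.*-comm 2 (k / 2)) ⟩
    k % 2 ℕ.+ k / 2 ℕ.* 2
      ≡⟨ m≡m%n+[m/n]*n k 2 ⟨
    k ∎
    where open ≡-Reasoning

  -- Since Q j only reads the y_i with i < j, m rounds of evaluating the Q j, starting from y = 0,
  -- reach values of y satisfying every extension axiom.
  module BinaryPoint {n m : ℕ} (Q : Fin m → Terms (n ℕ.+ m)) (Q-allowed : ∀ j → ExtAllowed n j (Q j)) (k : ℕ)
    where

    point : (Fin m → ℤ) → Fin (n ℕ.+ m) → ℤ
    point y = [ (λ i → + bit k (toℕ i)) , y ]′ ∘ splitAt n

    extension : ℕ → Fin m → ℤ
    extension zero    _ = 0ℤ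
    extension (suc t) j = eval (point (extension t)) (Q j)

    ρ : Fin (n ℕ.+ m) → ℤ
    ρ = point (extension m)

    point-x : ∀ y i → point y (xv m i) ≡ + bit k (toℕ i)
    point-x y i = cong [ (λ i → + bit k (toℕ i)) , y ]′ (Fin.splitAt-↑ˡ n i m)

    point-y : ∀ y j → point y (yv n j) ≡ y j
    point-y y j = cong [ (λ i → + bit k (toℕ i)) , y ]′ (Fin.splitAt-↑ʳ n m j)

    Q-local : ∀ j y y' → (∀ i → toℕ i < toℕ j → y i ≡ y' i) → eval (point y) (Q j) ≡ eval (point y') (Q j)
    Q-local j y y' agree = eval-local (point y) (point y') (Q j) (All.map (λ {t} → agreeOn t) (Q-allowed j))
      where
      agreeOn : ∀ t → (∀ i → toℕ j ≤ toℕ i → lookup (proj₂ t) (yv n i) ≡ 0) →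
                ∀ v → lookup (proj₂ t) v ≡ 0 ⊎ point y v ≡ point y' v
      agreeOn t no-late-y v with splitAt n v in split≡
      ... | inj₁ _ = inj₂ refl
      ... | inj₂ i with toℕ j ℕ.≤? toℕ i
      ...   | yes j≤i = inj₁ (subst (λ w → lookup (proj₂ t) w ≡ 0) (Fin.splitAt⁻¹-↑ʳ split≡) (no-late-y i j≤i))
      ...   | no j≰i  = inj₂ (agree i (ℕ.≰⇒> j≰i))

    extension-stable : ∀ t j → toℕ j < t → extension (suc t) j ≡ extension t j
    extension-stable (suc t) j j<1+t =
      Q-local j (extension (suc t)) (extension t) λ i i<j → extension-stable t i (ℕ.<-≤-trans i<j (ℕ.≤-pred j<1+t))

    ρ-extension : ∀ j → ρ (yv n j) ≡ eval ρ (Q j)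
    ρ-extension j = trans (point-y (extension m) j) (sym (extension-stable m j (Fin.toℕ<n j)))

    eval-bvpMain : k < 2 ^ n → eval ρ (bvpMain n m) ≡ + suc k
    eval-bvpMain k<2^n = begin
      eval ρ (map x-term (allFin n) ++ const (+ 1))          ≡⟨ eval-++ ρ (map x-term (allFin n)) (const (+ 1)) ⟩
      eval ρ (map x-term (allFin n)) + eval ρ (const (+ 1))  ≡⟨ cong₂ _+_ (cong (eval ρ) (List.map-tabulate id x-term))
                                                                         (eval-const ρ (+ 1)) ⟩
      eval ρ (tabulate x-term) + + 1                         ≡⟨ cong (_+ + 1) (eval-tabulate ρ x-term digit x-term≡) ⟩
      + sum (tabulate digit) + + 1                           ≡⟨ cong (λ s → + (s ℕ.+ 1)) (binaryExpansion n k k<2^n) ⟩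
      + (k ℕ.+ 1)                                            ≡⟨ cong +_ (ℕ.+-comm k 1) ⟩
      + suc k                                                ∎
      where
      open ≡-Reasoning
      x-term : Fin n → ℤ × Monomial (n ℕ.+ m)
      x-term i = (+ (2 ^ toℕ i) , var (xv m i))
      digit : Fin n → ℕ
      digit i = 2 ^ toℕ i ℕ.* bit k (toℕ i)
      x-term≡ : ∀ i → + (2 ^ toℕ i) * evalMono ρ (var (xv m i)) ≡ + digit i
      x-term≡ i = trans (cong (+ (2 ^ toℕ i) *_) (trans (evalMono-var ρ (xv m i)) (point-x (extension m) i)))
                        (sym (ℤ.pos-* (2 ^ toℕ i) (bit k (toℕ i))))

    eval-boolAx : ∀ i → eval ρ (boolAx (xv m i)) ≡ 0ℤ
    eval-boolAx i =
      trans (cong₂ (λ x² x → 1ℤ * x² + (-1ℤ * x + 0ℤ)) (evalMono-var² ρ (xv m i)) (evalMono-var ρ (xv m i)))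
            (trans (cong (λ x² → 1ℤ * x² + (-1ℤ * ρ (xv m i) + 0ℤ)) x²≡x) (x-x≡0 (ρ (xv m i))))
      where
      x-x≡0 : ∀ x → 1ℤ * x + (-1ℤ * x + 0ℤ) ≡ 0ℤ
      x-x≡0 = solve-∀
      boolean : ∀ b → b ≤ 1 → + b * + b ≡ + b
      boolean zero          _ = refl
      boolean (suc zero)    _ = refl
      boolean (suc (suc b)) (s≤s ())
      x²≡x : ρ (xv m i) * ρ (xv m i) ≡ ρ (xv m i)
      x²≡x rewrite point-x (extension m) i = boolean (bit k (toℕ i)) (bit≤1 k (toℕ i))

    eval-extAxiom : ∀ j → eval ρ ((+ 1 , var (yv n j)) ∷ neg (Q j)) ≡ 0ℤ
    eval-extAxiom j = trans (cong₂ (λ y q → 1ℤ * y + q) (trans (evalMono-var ρ (yv n j)) (ρ-extension j))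
                                                       (eval-scale ρ -1ℤ (Q j)))
                            (y-y≡0 (eval ρ (Q j)))
      where
      y-y≡0 : ∀ y → 1ℤ * y + -1ℤ * y ≡ 0ℤ
      y-y≡0 = solve-∀

    axioms∣ : k < 2 ^ n → All (λ g → + suc k ∣ eval ρ g) (BVP n m ++ extAxioms n m Q)
    axioms∣ k<2^n =
      All.++⁺ (∣-reflexive (sym (eval-bvpMain k<2^n)) ∷ All.map⁺ (All.tabulate⁺ (∣0 ∘ eval-boolAx)))
              (All.map⁺ (All.tabulate⁺ (∣0 ∘ eval-extAxiom)))
      where
      ∣0 : ∀ {z} → z ≡ 0ℤ → + suc k ∣ z
      ∣0 refl = divides 0ℤ refl

open import Data.Nat using (ℕ; zero; suc; _≤_; _<_; _*_; _^_; _∸_; z≤n; s≤s; _≤?_)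
open import Data.Nat.Properties
  using (≤-trans; ≤-reflexive; <⇒≤; <⇒≱; ≰⇒>; n≤1+n; n≢0⇒n>0; m^n>0; *-identityˡ; *-monoʳ-≤; *-monoˡ-≤;
         ^-monoʳ-≤; ^-distribˡ-+-*; m+[n∸m]≡n; module ≤-Reasoning)
open import Data.Nat.Divisibility using (_∣_)
open import Data.Nat.Primality using (Prime; euclidsLemma; ¬prime[0])
open import Data.Nat.Logarithm using (⌈log₂_⌉; ⌈log₂⌉-mono-≤; ⌈log₂2^n⌉≡n; ⌊log₂⌋-mono-≤; ⌊log₂[2^n]⌋≡n)
open import Data.Integer as ℤ using (∣_∣; +_)
import Data.Integer.Properties as ℤ
import Data.Integer.Divisibility.Signed as ℤ
open import Data.Fin using (Fin)
open import Data.Product using (Σ; _×_; _,_)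
open import Data.Sum using (inj₁; inj₂)
open import Function using (_∘_)
open import Relation.Nullary using (Dec; yes; no)
open import Relation.Nullary.Negation using (contradiction)
open import Relation.Binary.PropositionalEquality
open ChebyshevBound using (2^2^[n∸4]≤M)
open Evaluation using (refutation-∣; log₂∣M∣≤size; module BinaryPoint)

prime-∣z*z⇒∣z : ∀ {p} → Prime p → ∀ z → + p ℤ.∣ z ℤ.* z → + p ℤ.∣ z
prime-∣z*z⇒∣z p-prime z p∣z*z with euclidsLemma ∣ z ∣ ∣ z ∣ p-prime (subst (_ ∣_) (ℤ.abs-* z z) (ℤ.∣⇒∣ᵤ p∣z*z))
... | inj₁ p∣z = ℤ.∣ᵤ⇒∣ p∣z
... | inj₂ p∣z = ℤ.∣ᵤ⇒∣ p∣z

E≤⌈log₂⌉ : ∀ {E x} → 2 ^ E ≤ x → E ≤ ⌈log₂ x ⌉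
E≤⌈log₂⌉ {E} 2^E≤x = subst (_≤ _) (⌈log₂2^n⌉≡n E) (⌈log₂⌉-mono-≤ 2^E≤x)

E≤bits : ∀ {E x} → 2 ^ E ≤ x → E ≤ bits x
E≤bits {E} {zero}  2^E≤0 = contradiction 2^E≤0 (<⇒≱ (m^n>0 2 E))
E≤bits {E} {suc x} 2^E≤x = ≤-trans (subst (_≤ _) (⌊log₂[2^n]⌋≡n E) (⌊log₂⌋-mono-≤ 2^E≤x)) (n≤1+n _)

0<bits : ∀ {x} → 0 < x → 0 < bits x
0<bits {suc x} _ = s≤s z≤n

2^n≡16*2^[n∸4] : ∀ {n} → 4 ≤ n → 2 ^ n ≡ 16 * 2 ^ (n ∸ 4)
2^n≡16*2^[n∸4] {n} 4≤n = trans (cong (2 ^_) (sym (m+[n∸m]≡n 4≤n))) (^-distribˡ-+-* 2 4 (n ∸ 4))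

module _ {n m} {Q : Fin m → Terms (n Data.Nat.+ m)} (Q-allowed : ∀ j → ExtAllowed n j (Q j))
         (π : ExtRefutation n m Q) where
  open Refutation π

  primes∣M : ∀ p → Prime p → p < 2 ^ n → p ∣ ∣ M ∣
  primes∣M zero    p-prime _     = contradiction p-prime ¬prime[0]
  primes∣M (suc k) p-prime p<2^n =
    ℤ.∣⇒∣ᵤ (refutation-∣ ρ (prime-∣z*z⇒∣z p-prime) (axioms∣ (<⇒≤ p<2^n)) π)
    where open BinaryPoint Q Q-allowed k

  0<∣M∣ : 0 < ∣ M ∣
  0<∣M∣ = n≢0⇒n>0 (M≢0 ∘ ℤ.∣i∣≡0⇒i≡0)

  2^2^[n∸4]≤∣M∣ : 25 ≤ n → 2 ^ 2 ^ (n ∸ 4) ≤ ∣ M ∣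
  2^2^[n∸4]≤∣M∣ 25≤n = 2^2^[n∸4]≤M n 25≤n 0<∣M∣ primes∣M

  2^n≤16*size : 25 ≤ n → 2 ^ n ≤ 16 * size
  2^n≤16*size 25≤n = begin
    2 ^ n                 ≡⟨ 2^n≡16*2^[n∸4] (≤-trans (s≤s (s≤s (s≤s (s≤s z≤n)))) 25≤n) ⟩
    16 * 2 ^ (n ∸ 4)      ≤⟨ *-monoʳ-≤ 16 (E≤⌈log₂⌉ {2 ^ (n ∸ 4)} (2^2^[n∸4]≤∣M∣ 25≤n)) ⟩
    16 * ⌈log₂ ∣ M ∣ ⌉     ≤⟨ *-monoʳ-≤ 16 (log₂∣M∣≤size π) ⟩
    16 * size             ∎
    where open ≤-Reasoning

  -- Case split through a helper: a with-abstraction would normalise 2 ^ 25 * bits ∣ M ∣ in unary.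
  2^n≤2^25*bits : 2 ^ n ≤ 2 ^ 25 * bits ∣ M ∣
  2^n≤2^25*bits = byCases (25 ≤? n)
    where
    open ≤-Reasoning
    byCases : Dec (25 ≤ n) → 2 ^ n ≤ 2 ^ 25 * bits ∣ M ∣
    byCases (yes 25≤n) = begin
      2 ^ n               ≡⟨ 2^n≡16*2^[n∸4] (≤-trans (s≤s (s≤s (s≤s (s≤s z≤n)))) 25≤n) ⟩
      16 * 2 ^ (n ∸ 4)    ≤⟨ *-monoʳ-≤ 16 (E≤bits {2 ^ (n ∸ 4)} (2^2^[n∸4]≤∣M∣ 25≤n)) ⟩
      16 * bits ∣ M ∣      ≤⟨ *-monoˡ-≤ (bits ∣ M ∣) (^-monoʳ-≤ 2 {4} {25} (s≤s (s≤s (s≤s (s≤s z≤n))))) ⟩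
      2 ^ 25 * bits ∣ M ∣  ∎
    byCases (no 25≰n) = begin
      2 ^ n               ≤⟨ ^-monoʳ-≤ 2 (<⇒≤ (≰⇒> 25≰n)) ⟩
      2 ^ 25 * 1          ≤⟨ *-monoʳ-≤ (2 ^ 25) (0<bits 0<∣M∣) ⟩
      2 ^ 25 * bits ∣ M ∣  ∎

theorem3p1 :
    Σ ℕ λ c₁ → Σ ℕ λ d₁ → Σ ℕ λ n₀ → Σ ℕ λ c₂ → Σ ℕ λ d₂ →
      (0 < c₁) × (0 < d₁) × (0 < c₂) × (0 < d₂) ×
      ((n m : ℕ) (Q : Fin m → Terms (n Data.Nat.+ m)) →
        ((j : Fin m) → ExtAllowed n j (Q j)) →
        (π : ExtRefutation n m Q) →
          (n₀ ≤ n → c₁ * 2 ^ n ≤ d₁ * Refutation.size π)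
          × (c₂ * 2 ^ n ≤ d₂ * bits ∣ Refutation.M π ∣)
          × ((p : ℕ) → Prime p → p < 2 ^ n → p ∣ (∣ Refutation.M π ∣)))
theorem3p1 = 1 , 16 , 25 , 1 , 2 ^ 25 , s≤s z≤n , s≤s z≤n , s≤s z≤n , m^n>0 2 25 ,
  λ n m Q Q-allowed π →
    (λ 25≤n → ≤-trans (≤-reflexive (*-identityˡ (2 ^ n))) (2^n≤16*size Q-allowed π 25≤n)) ,
    ≤-trans (≤-reflexive (*-identityˡ (2 ^ n))) (2^n≤2^25*bits Q-allowed π) ,
    primes∣M Q-allowed π
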